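{- Let $k,r\ge 0$ be integers. (1) If $H'$ and $H$ are $k$-precolored graphs, $H'$ is a subgraph of $H$, and Spoiler has a winning strategy in $\mathcal G^k_r(H')$, then Spoiler has a winning strategy in $\mathcal G^k_r(H)$. (2) If $H'$ and $H$ are $k$-precolored graphs, there is a homomorphism from $H'$ to $H$, and Duplicator has a winning strategy in $\mathcal G^k_r(H)$, then Duplicator has a winning strategy in $\mathcal G^k_r(H')$.
   Context: A $k$-precolored graph is a finite simple graph in which at most $k$ vertices are assigned colors from $\{\text{red},\text{blue},\text{green}\}$ (the other vertices are uncolored). A $k$-precolored graph $H'$ is a subgraph of a $k$-precolored graph $H$ if the underlying graph of $H'$ is a subgraph of that of $H$ and every vertex colored in $H'$ is colored with the same color in $H$ (a vertex colored in $H$ may be uncolored in $H'$). A homomorphism from $H'$ to $H$ is a graph homomorphism of the underlying graphs mapping each colored vertex of $H'$ to a vertex of $H$ colored with the same color (uncolored vertices may be mapped to any vertices). The game $\mathcal G^k_r(H)$ is played by Spoiler and Duplicator on a $k$-precolored graph $H$; the initial position is the given partial coloring. In each of $r$ rounds, Spoiler may first erase the color of a colored vertex and then selects a vertex, which Duplicator colors red, blue or green; after each round at most $k$ vertices may be colored. Duplicator wins if the partial coloring is proper (no two adjacent colored vertices have the same color) initially and after each of the $r$ rounds; otherwise Spoiler wins. A player "wins" a game if he/she has a winning strategy in it. -}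

module Defs where

open import Data.Nat using (ℕ; zero; suc; _+_; _≤_)
open import Data.Fin using (Fin; zero; suc)
open import Data.Fin.Properties using (_≟_)
open import Data.Bool using (Bool; true; false)
open import Data.Maybe using (Maybe; just; nothing)
open import Data.Product using (Σ; _×_; _,_; ∃)
open import Data.Sum using (_⊎_)
open import Data.Empty using (⊥)
open import Data.Unit using (⊤)
open import Relation.Nullary using (¬_; yes; no)
open import Relation.Binary.PropositionalEquality using (_≡_; _≢_)
open import Function.Definitions using (Injective)

data Color : Set where
  red blue green : Color

record Graph : Set where
  field
    n       : ℕ
    adj     : Fin n → Fin n → Bool
    sym     : ∀ u v → adj u v ≡ adj v u
    irrefl  : ∀ v → adj v v ≡ false
open Graph public

Coloring : ℕ → Set
Coloring n = Fin n → Maybe Color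

isColored : Maybe Color → Bool
isColored (just _) = true
isColored nothing  = false

countColored : ∀ {n} → Coloring n → ℕ
countColored {zero}  c = 0
countColored {suc n} c with c zero
... | just _  = suc (countColored {n} (λ i → c (suc i)))
... | nothing = countColored {n} (λ i → c (suc i))

Proper : (G : Graph) → Coloring (n G) → Set
Proper G c = ∀ u v → adj G u v ≡ true → ∀ a → c u ≡ just a → c v ≡ just a → ⊥

record PGraph (k : ℕ) : Set where
  field
    graph    : Graph
    col      : Coloring (n graph)
    atMostK  : countColored col ≤ k
open PGraph public

erase : ∀ {n} → Maybe (Fin n) → Coloring n → Coloring n
erase nothing  c = c
erase (just u) c w with w ≟ u
... | yes _ = nothing
... | no  _ = c w

setCol : ∀ {n} → Fin n → Color → Coloring n → Coloring n
setCol v a c w with w ≟ v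
... | yes _ = just a
... | no  _ = c w

ErasureOK : ∀ {n} → Coloring n → Maybe (Fin n) → Set
ErasureOK c nothing  = ⊤
ErasureOK c (just u) = isColored (c u) ≡ true

-- Position after a round: Spoiler erases e (optional), selects v, Duplicator colors v with a.
step : ∀ {n} → Coloring n → Maybe (Fin n) → Fin n → Color → Coloring n
step c e v a = setCol v a (erase e c)

-- A Spoiler move (e , v) is legal if the erasure is of a colored vertex and after the round
-- at most k vertices are colored (independent of the color chosen by Duplicator).
LegalMove : ∀ {n} (k : ℕ) → Coloring n → Maybe (Fin n) → Fin n → Set
LegalMove k c e v = ErasureOK c e × countColored (step c e v red) ≤ k

DupWins : (k : ℕ) (G : Graph) → ℕ → Coloring (n G) → Set
DupWins k G zero    c = Proper G c
DupWins k G (suc r) c =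
  Proper G c × (∀ e v → LegalMove k c e v → Σ Color λ a → DupWins k G r (step c e v a))

SpWins : (k : ℕ) (G : Graph) → ℕ → Coloring (n G) → Set
SpWins k G zero    c = ¬ Proper G c
SpWins k G (suc r) c =
  ¬ Proper G c ⊎ Σ (Maybe (Fin (n G))) λ e → Σ (Fin (n G)) λ v →
    LegalMove k c e v × (∀ a → SpWins k G r (step c e v a))

DuplicatorWins : ∀ {k} → ℕ → PGraph k → Set
DuplicatorWins {k} r H = DupWins k (graph H) r (col H)

SpoilerWins : ∀ {k} → ℕ → PGraph k → Set
SpoilerWins {k} r H = SpWins k (graph H) r (col H)

ColorRespecting : ∀ {k} (H' H : PGraph k) → (Fin (n (graph H')) → Fin (n (graph H))) → Set
ColorRespecting H' H f = ∀ v a → col H' v ≡ just a → col H (f v) ≡ just a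

EdgePreserving : ∀ {k} (H' H : PGraph k) → (Fin (n (graph H')) → Fin (n (graph H))) → Set
EdgePreserving H' H f = ∀ u v → adj (graph H') u v ≡ true → adj (graph H) (f u) (f v) ≡ true

-- H' is a subgraph of H (up to identifying H' with its image under an injective embedding).
Subgraph : ∀ {k} → PGraph k → PGraph k → Set
Subgraph H' H = Σ (Fin (n (graph H')) → Fin (n (graph H))) λ f →
  Injective _≡_ _≡_ f × EdgePreserving H' H f × ColorRespecting H' H f

Hom : ∀ {k} → PGraph k → PGraph k → Set
Hom H' H = Σ (Fin (n (graph H')) → Fin (n (graph H))) λ f →
  EdgePreserving H' H f × ColorRespecting H' H f

-- Both halves are proved by letting the winner of the game on one graph play the game on the
-- other graph through f, keeping the invariant that every vertex w colored in the H'-position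
-- has the same color at f w in the H-position.  Properness then transfers from H to H' because
-- f preserves edges.  When Spoiler's move on H' selects v, the move on H selects f v.  If f v is
-- already colored, Duplicator on H' simply copies its color (the H-position does not change),
-- while Spoiler on H recolors f v, which keeps the invariant only because f is injective.  If f v
-- is uncolored and the H-position is full, the H-move must also erase a vertex: one that is not
-- the image of a colored vertex of the H'-position.  Such a vertex exists by counting, since
-- after its own erasure the H'-position has fewer colored vertices than the H-position.

module Submission where

open import Defs hiding (sym)
open import Data.Bool using (Bool; true; false)
import Data.Bool.Properties as Bool
open import Data.Empty using (⊥-elim)
open import Data.Fin using (Fin; zero; suc)
open import Data.Fin.Properties using (_≟_; suc-injective; ¬Fin0; any?; ¬∀⟶∃¬)
open import Data.Maybe using (Maybe; just; nothing)
open import Data.Nat using (ℕ; zero; suc; _+_; _≤_; _<_; s≤s; _≤?_)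
open import Data.Nat.Properties using (+-suc; ≤-trans; ≤-reflexive; n≤1+n; <⇒≱; ≰⇒>; <-≤-trans; m<1+n⇒m≤n)
open import Data.Product using (Σ; ∃; _×_; _,_; proj₁; proj₂)
open import Data.Sum using (inj₁; inj₂)
open import Data.Unit using (tt)
open import Function using (_∘_)
open import Function.Definitions using (Injective)
open import Relation.Nullary using (Dec; yes; no)
open import Relation.Nullary.Decidable using (_→-dec_; _×-dec_)
open import Relation.Binary.PropositionalEquality
  using (_≡_; _≢_; refl; sym; trans; cong; cong₂; subst; subst₂; module ≡-Reasoning)

bit : Bool → ℕ
bit true  = 1
bit false = 0

count : ∀ {n} → (Fin n → Bool) → ℕ
count {zero}  p = 0
count {suc n} p = bit (p zero) + count (p ∘ suc)

count-cong : ∀ {n} {p q : Fin n → Bool} → (∀ w → p w ≡ q w) → count p ≡ count q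
count-cong {zero}  p≗q = refl
count-cong {suc n} p≗q = cong₂ _+_ (cong bit (p≗q zero)) (count-cong (p≗q ∘ suc))

count-≡0 : ∀ {n} (p : Fin n → Bool) → (∀ w → p w ≡ false) → count p ≡ 0
count-≡0 {zero}  p p≗false = refl
count-≡0 {suc n} p p≗false rewrite p≗false zero = count-≡0 (p ∘ suc) (p≗false ∘ suc)

count-insert : ∀ {n} (p q : Fin n → Bool) (v : Fin n) → (∀ w → w ≢ v → p w ≡ q w) →
  p v ≡ false → q v ≡ true → count q ≡ suc (count p)
count-insert p q zero p≗q pv qv rewrite pv | qv =
  cong suc (sym (count-cong (λ w → p≗q (suc w) λ ())))
count-insert p q (suc v) p≗q pv qv rewrite p≗q zero (λ ()) =
  trans (cong (bit (q zero) +_) (count-insert (p ∘ suc) (q ∘ suc) v p∘suc≗q∘suc pv qv))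
        (+-suc (bit (q zero)) _)
  where
  p∘suc≗q∘suc : ∀ w → w ≢ v → p (suc w) ≡ q (suc w)
  p∘suc≗q∘suc w w≢v = p≗q (suc w) (w≢v ∘ suc-injective)

without : ∀ {n} → Fin n → (Fin n → Bool) → Fin n → Bool
without y p x with x ≟ y
... | yes _ = false
... | no  _ = p x

without-≡ : ∀ {n} (y : Fin n) (p : Fin n → Bool) → without y p y ≡ false
without-≡ y p with y ≟ y
... | yes _   = refl
... | no  y≢y = ⊥-elim (y≢y refl)

without-≢ : ∀ {n} {x y : Fin n} (p : Fin n → Bool) → x ≢ y → without y p x ≡ p x
without-≢ {x = x} {y} p x≢y with x ≟ y
... | yes x≡y = ⊥-elim (x≢y x≡y)
... | no  _   = refl

count≤suc-without : ∀ {n} (y : Fin n) (p : Fin n → Bool) → count p ≤ suc (count (without y p))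
count≤suc-without y p with p y in py
... | true  = ≤-reflexive (count-insert (without y p) p y (λ w → without-≢ p) (without-≡ y p) py)
... | false = ≤-trans (≤-reflexive (count-cong p≗without)) (n≤1+n _)
  where
  p≗without : ∀ w → p w ≡ without y p w
  p≗without w with w ≟ y
  ... | yes refl = py
  ... | no  _    = refl

Covered : ∀ {n' n} → (Fin n' → Fin n) → (Fin n' → Bool) → (Fin n → Bool) → Fin n → Set
Covered f q p x = p x ≡ true → ∃ λ w → q w ≡ true × f w ≡ x

covered? : ∀ {n' n} (f : Fin n' → Fin n) (q : Fin n' → Bool) (p : Fin n → Bool) x → Dec (Covered f q p x)
covered? f q p x = (p x Bool.≟ true) →-dec any? (λ w → (q w Bool.≟ true) ×-dec (f w ≟ x))

count-≤-cover : ∀ {n' n} (f : Fin n' → Fin n) (q : Fin n' → Bool) (p : Fin n → Bool) →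
  (∀ x → Covered f q p x) → count p ≤ count q
count-≤-cover {zero} f q p cover =
  ≤-reflexive (count-≡0 p λ x → Bool.¬-not (¬Fin0 ∘ proj₁ ∘ cover x))
count-≤-cover {suc n'} f q p cover with q zero in q0
... | false = count-≤-cover (f ∘ suc) (q ∘ suc) p cover-tail
  where
  cover-tail : ∀ x → Covered (f ∘ suc) (q ∘ suc) p x
  cover-tail x px with cover x px
  ... | zero  , q0′ , _ with () ← trans (sym q0) q0′
  ... | suc w , qw  , fw = w , qw , fw
... | true = ≤-trans (count≤suc-without (f zero) p)
                     (s≤s (count-≤-cover (f ∘ suc) (q ∘ suc) (without (f zero) p) cover-tail))
  where
  cover-tail : ∀ x → Covered (f ∘ suc) (q ∘ suc) (without (f zero) p) x
  cover-tail x px with x ≟ f zero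
  cover-tail x () | yes _
  ... | no x≢f0 with cover x px
  ...   | zero  , _  , f0≡x = ⊥-elim (x≢f0 (sym f0≡x))
  ...   | suc w , qw , fw   = w , qw , fw

uncovered : ∀ {n' n} (f : Fin n' → Fin n) (q : Fin n' → Bool) (p : Fin n → Bool) →
  count q < count p → ∃ λ x → p x ≡ true × ∀ w → q w ≡ true → f w ≢ x
uncovered {n = n} f q p q<p
  with ¬∀⟶∃¬ n (Covered f q p) (covered? f q p) (<⇒≱ q<p ∘ count-≤-cover f q p)
... | x , ¬covered with p x Bool.≟ true
...   | yes px = x , px , λ w qw fw≡x → ¬covered (λ _ → w , qw , fw≡x)
...   | no ¬px = ⊥-elim (¬covered (⊥-elim ∘ ¬px))

colored : ∀ {n} → Coloring n → Fin n → Bool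
colored c w = isColored (c w)

countColored≡count : ∀ {n} (c : Coloring n) → countColored c ≡ count (colored c)
countColored≡count {zero}  c = refl
countColored≡count {suc n} c with c zero
... | just _  = cong suc (countColored≡count (c ∘ suc))
... | nothing = countColored≡count (c ∘ suc)

setCol-≡ : ∀ {n} (v : Fin n) a (c : Coloring n) → setCol v a c v ≡ just a
setCol-≡ v a c with v ≟ v
... | yes _   = refl
... | no  v≢v = ⊥-elim (v≢v refl)

setCol-≢ : ∀ {n} {w v : Fin n} a (c : Coloring n) → w ≢ v → setCol v a c w ≡ c w
setCol-≢ {w = w} {v} a c w≢v with w ≟ v
... | yes w≡v = ⊥-elim (w≢v w≡v)
... | no  _   = refl

erase-≡ : ∀ {n} (u : Fin n) (c : Coloring n) → erase (just u) c u ≡ nothing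
erase-≡ u c with u ≟ u
... | yes _   = refl
... | no  u≢u = ⊥-elim (u≢u refl)

erase-≢ : ∀ {n} {w u : Fin n} (c : Coloring n) → w ≢ u → erase (just u) c w ≡ c w
erase-≢ {w = w} {u} c w≢u with w ≟ u
... | yes w≡u = ⊥-elim (w≢u w≡u)
... | no  _   = refl

erase-just : ∀ {n} (e : Maybe (Fin n)) (c : Coloring n) {w a} → erase e c w ≡ just a → c w ≡ just a
erase-just nothing  c cw = cw
erase-just (just u) c {w} cw with w ≟ u
erase-just (just u) c () | yes _
... | no _ = cw

countColored-cong : ∀ {n} {c d : Coloring n} → (∀ w → colored c w ≡ colored d w) →
  countColored c ≡ countColored d
countColored-cong {c = c} {d} c≗d = begin
  countColored c     ≡⟨ countColored≡count c ⟩
  count (colored c)  ≡⟨ count-cong c≗d ⟩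
  count (colored d)  ≡⟨ sym (countColored≡count d) ⟩
  countColored d     ∎
  where open ≡-Reasoning

countColored-insert : ∀ {n} (c d : Coloring n) (v : Fin n) → (∀ w → w ≢ v → c w ≡ d w) →
  colored c v ≡ false → colored d v ≡ true → countColored d ≡ suc (countColored c)
countColored-insert c d v c≗d cv dv = begin
  countColored d           ≡⟨ countColored≡count d ⟩
  count (colored d)        ≡⟨ count-insert (colored c) (colored d) v (λ w → cong isColored ∘ c≗d w) cv dv ⟩
  suc (count (colored c))  ≡⟨ cong suc (sym (countColored≡count c)) ⟩
  suc (countColored c)     ∎
  where open ≡-Reasoning

countColored-setCol-uncolored : ∀ {n} (v : Fin n) a (c : Coloring n) → c v ≡ nothing →
  countColored (setCol v a c) ≡ suc (countColored c)
countColored-setCol-uncolored v a c cv =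
  countColored-insert c (setCol v a c) v (λ w → sym ∘ setCol-≢ a c) (cong isColored cv)
    (cong isColored (setCol-≡ v a c))

countColored-setCol-colored : ∀ {n} (v : Fin n) a b (c : Coloring n) → c v ≡ just b →
  countColored (setCol v a c) ≡ countColored c
countColored-setCol-colored v a b c cv = countColored-cong colored-same
  where
  colored-same : ∀ w → colored (setCol v a c) w ≡ colored c w
  colored-same w with w ≟ v
  ... | yes refl = cong isColored (sym cv)
  ... | no  _    = refl

countColored-setCol-recolor : ∀ {n} (v : Fin n) a b (c : Coloring n) →
  countColored (setCol v a c) ≡ countColored (setCol v b c)
countColored-setCol-recolor v a b c = countColored-cong colored-same
  where
  colored-same : ∀ w → colored (setCol v a c) w ≡ colored (setCol v b c) w
  colored-same w with w ≟ v
  ... | yes _ = refl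
  ... | no  _ = refl

countColored-erase : ∀ {n} (u : Fin n) (c : Coloring n) → colored c u ≡ true →
  countColored c ≡ suc (countColored (erase (just u) c))
countColored-erase u c cu =
  countColored-insert (erase (just u) c) c u (λ w → erase-≢ c) (cong isColored (erase-≡ u c)) cu

legal-any-color : ∀ {n k} (c : Coloring n) e v a →
  countColored (step c e v red) ≤ k → countColored (step c e v a) ≤ k
legal-any-color {k = k} c e v a = subst (_≤ k) (countColored-setCol-recolor v red a (erase e c))

record ExtendsAlong {n' n} (f : Fin n' → Fin n) (c' : Coloring n') (c : Coloring n) : Set where
  constructor extends
  field
    image-color : ∀ {w a} → c' w ≡ just a → c (f w) ≡ just a
open ExtendsAlong

DupWins-pred : ∀ {k} {G : Graph} r c → DupWins k G (suc r) c → DupWins k G r c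
DupWins-pred zero    c (proper , _)       = proper
DupWins-pred (suc r) c (proper , respond) = proper , λ e v legal →
  let (a , win) = respond e v legal in a , DupWins-pred r _ win

module MoveTransfer (k : ℕ) {n' n} (f : Fin n' → Fin n) where

  extendsAlong-erase : ∀ {c' c} e → ExtendsAlong f c' c → ExtendsAlong f (erase e c') c
  extendsAlong-erase {c'} e ext = extends (image-color ext ∘ erase-just e c')

  extendsAlong-step : ∀ {c'} d e v a →
    (∀ {w b} → erase e c' w ≡ just b → w ≢ v → f w ≢ f v × d (f w) ≡ just b) →
    ExtendsAlong f (step c' e v a) (setCol (f v) a d)
  extendsAlong-step {c'} d e v a old = extends colors
    where
    colors : ∀ {w b} → step c' e v a w ≡ just b → setCol (f v) a d (f w) ≡ just b
    colors {w} cw with w ≟ v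
    ... | yes refl = trans (setCol-≡ (f v) a d) cw
    ... | no  w≢v  = let (fw≢fv , dfw) = old cw w≢v in trans (setCol-≢ a d fw≢fv) dfw

  extendsAlong-copy : ∀ {c' c} e v {b} → ExtendsAlong f c' c → c (f v) ≡ just b →
    ExtendsAlong f (step c' e v b) c
  extendsAlong-copy {c'} {c} e v {b} ext cfv = extends colors
    where
    colors : ∀ {w a} → step c' e v b w ≡ just a → c (f w) ≡ just a
    colors {w} cw with w ≟ v
    ... | yes refl = trans cfv cw
    ... | no  _    = image-color ext (erase-just e c' cw)

  image-of-colored : ∀ {c' c} v {w b} → ExtendsAlong f c' c → c (f v) ≡ nothing → c' w ≡ just b →
    f w ≢ f v
  image-of-colored {c = c} v {b = b} ext cfv cw fw≡fv
    with () ← trans (sym cfv) (subst (λ x → c x ≡ just b) fw≡fv (image-color ext cw))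

  erased-room : ∀ {c' c} e v → ExtendsAlong f c' c → c (f v) ≡ nothing → LegalMove k c' e v →
    suc (countColored (erase e c')) ≤ k
  erased-room {c'} e v ext cfv (_ , step≤k) =
    subst (_≤ k) (countColored-setCol-uncolored v red (erase e c') erased-v) step≤k
    where
    erased-v : erase e c' v ≡ nothing
    erased-v with erase e c' v in cv
    ... | nothing = refl
    ... | just b  = ⊥-elim (image-of-colored v (extendsAlong-erase e ext) cfv cv refl)

  Answer : Coloring n' → Coloring n → Maybe (Fin n') → Fin n' → Maybe (Fin n) → Set
  Answer c' c e v eH = LegalMove k c eH (f v) × ∀ a → ExtendsAlong f (step c' e v a) (step c eH (f v) a)

  answer-with-room : ∀ {c' c} e v → ExtendsAlong f c' c → c (f v) ≡ nothing →
    suc (countColored c) ≤ k → Answer c' c e v nothing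
  answer-with-room {c = c} e v ext cfv room =
    (tt , subst (_≤ k) (sym (countColored-setCol-uncolored (f v) red c cfv)) room) ,
    λ a → extendsAlong-step c e v a λ cw _ → image-of-colored v ext′ cfv cw , image-color ext′ cw
    where ext′ = extendsAlong-erase e ext

  answer-by-eviction : ∀ {c' c} e v x → ExtendsAlong f c' c → c (f v) ≡ nothing → countColored c ≤ k →
    colored c x ≡ true → (∀ w → colored (erase e c') w ≡ true → f w ≢ x) → Answer c' c e v (just x)
  answer-by-eviction {c' = c'} {c} e v x ext cfv c≤k cx x-free =
    (cx , subst (_≤ k) (sym evicted-count) c≤k) ,
    λ a → extendsAlong-step (erase (just x) c) e v a λ {w} cw _ →
      image-of-colored v ext′ cfv cw ,
      trans (erase-≢ c (x-free w (cong isColored cw))) (image-color ext′ cw)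
    where
    ext′ = extendsAlong-erase e ext
    fv≢x : f v ≢ x
    fv≢x refl with () ← trans (sym (cong isColored cfv)) cx
    evicted-count : countColored (step c (just x) (f v) red) ≡ countColored c
    evicted-count =
      trans (countColored-setCol-uncolored (f v) red (erase (just x) c) (trans (erase-≢ c fv≢x) cfv))
            (sym (countColored-erase x c cx))

  answer : ∀ {c' c} e v → ExtendsAlong f c' c → countColored c ≤ k → LegalMove k c' e v →
    c (f v) ≡ nothing → ∃ (Answer c' c e v)
  answer {c'} {c} e v ext c≤k legal cfv with suc (countColored c) ≤? k
  ... | yes room = nothing , answer-with-room e v ext cfv room
  ... | no  full =
    let (x , cx , x-free) = uncovered f (colored (erase e c')) (colored c)
                              (subst₂ _<_ (countColored≡count (erase e c')) (countColored≡count c)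
                                (<-≤-trans (erased-room e v ext cfv legal) (m<1+n⇒m≤n (≰⇒> full))))
    in just x , answer-by-eviction e v x ext cfv c≤k cx x-free

module Simulation (k : ℕ) {G' G : Graph} (f : Fin (n G') → Fin (n G))
  (f-adj : ∀ u v → adj G' u v ≡ true → adj G (f u) (f v) ≡ true) where
  open MoveTransfer k f

  proper-pullback : ∀ {c' c} → ExtendsAlong f c' c → Proper G c → Proper G' c'
  proper-pullback ext proper u v uv a cu cv =
    proper (f u) (f v) (f-adj u v uv) a (image-color ext cu) (image-color ext cv)

  duplicator : ∀ r {c' c} → ExtendsAlong f c' c → countColored c ≤ k →
    DupWins k G r c → DupWins k G' r c'
  duplicator zero    ext c≤k proper = proper-pullback ext proper
  duplicator (suc r) {c'} {c} ext c≤k (proper , respond) = proper-pullback ext proper , respond′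
    where
    respond′ : ∀ e v → LegalMove k c' e v → Σ Color λ a → DupWins k G' r (step c' e v a)
    respond′ e v legal with c (f v) in cfv
    ... | just b  = b , duplicator r (extendsAlong-copy e v ext cfv) c≤k (DupWins-pred r c (proper , respond))
    ... | nothing =
      let (eH , (legalH , ext′)) = answer e v ext c≤k legal cfv
          (a , win) = respond eH (f v) legalH
      in a , duplicator r (ext′ a) (legal-any-color c eH (f v) a (proj₂ legalH)) win

  spoiler : ∀ r → Injective _≡_ _≡_ f → ∀ {c' c} → ExtendsAlong f c' c → countColored c ≤ k →
    SpWins k G' r c' → SpWins k G r c
  spoiler zero    f-inj ext c≤k improper           = improper ∘ proper-pullback ext
  spoiler (suc r) f-inj ext c≤k (inj₁ improper)    = inj₁ (improper ∘ proper-pullback ext)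
  spoiler (suc r) f-inj {c'} {c} ext c≤k (inj₂ (e , v , legal , win)) with c (f v) in cfv
  ... | nothing =
    let (eH , (legalH , ext′)) = answer e v ext c≤k legal cfv
    in inj₂ (eH , f v , legalH , λ a →
         spoiler r f-inj (ext′ a) (legal-any-color c eH (f v) a (proj₂ legalH)) (win a))
  ... | just b = inj₂ (nothing , f v , (tt , recolor≤k) , λ a →
         spoiler r f-inj (extendsAlong-step c e v a kept) (legal-any-color c nothing (f v) a recolor≤k) (win a))
    where
    recolor≤k : countColored (step c nothing (f v) red) ≤ k
    recolor≤k = subst (_≤ k) (sym (countColored-setCol-colored (f v) red b c cfv)) c≤k
    kept : ∀ {w b′} → erase e c' w ≡ just b′ → w ≢ v → f w ≢ f v × c (f w) ≡ just b′
    kept cw w≢v = w≢v ∘ f-inj , image-color ext (erase-just e c' cw)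

lemma2 : (k r : ℕ) →
    ((H' H : PGraph k) → Subgraph H' H → SpoilerWins r H' → SpoilerWins r H)
    × ((H' H : PGraph k) → Hom H' H → DuplicatorWins r H → DuplicatorWins r H')
lemma2 k r =
  (λ H' H (f , f-inj , f-adj , f-col) →
     Simulation.spoiler k f f-adj r f-inj (extends (f-col _ _)) (atMostK H)) ,
  (λ H' H (f , f-adj , f-col) →
     Simulation.duplicator k f f-adj r (extends (f-col _ _)) (atMostK H))
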